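{- Let $f\in\mathbb{F}_q[t]$ be nonzero. Then $S(f)=f$ if and only if $f=t$ when $q>2$, and if and only if $f\in\{t,t^2\}$ when $q=2$.
   Context: Let $\mathbb{F}_q$ be a finite field with $q$ elements ($q$ a prime power). Fix an enumeration $\mathbb{F}_q=\{a_0,a_1,\dots,a_{q-1}\}$ with $a_0=0$, $a_1=1$. Every nonzero $f\in\mathbb{F}_q[t]$ of degree $m$ is uniquely written $f=a_{i_0}+a_{i_1}t+\dots+a_{i_m}t^m$ with $0\le i_j\le q-1$, $a_{i_m}\neq 0$. Put $\delta(f)=i_0+i_1q+\dots+i_mq^m$ and $\delta(0)=0$. Order $\mathbb{F}_q[t]$ by: $f>g$ iff $\delta(f)>\delta(g)$. For nonzero $f$, $f!=\prod_{g<f}(f-g)$ (product over all $g\in\mathbb{F}_q[t]$ with $g<f$), and $0!=1$. For nonzero $f$, $S(f)$ is the smallest $g$ (in this order) with $f\mid g!$; $S(0)=0$. -}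

module Defs where

open import Data.Nat as ℕ using (ℕ; zero; suc; _<_)
open import Data.Nat.DivMod using (_mod_; _div_)
open import Data.Fin as Fin using (Fin; toℕ)
open import Data.List using (List; []; _∷_; foldr; map; upTo)
open import Data.Product using (Σ; ∃; _×_; _,_)
open import Relation.Binary.PropositionalEquality using (_≡_; _≢_)
open import Relation.Nullary using (¬_)
open import Relation.Nullary.Decidable using (⌊_⌋)
open import Data.Bool using (Bool; true; false; if_then_else_)
open import Algebra.Structures using (IsCommutativeRing)

-- A finite field with q elements, transported along a fixed enumeration
-- F_q = {a_0, …, a_{q-1}}: the element a_i is represented by i : Fin q.
-- The convention a_0 = 0, a_1 = 1 is the requirement toℕ 0# ≡ 0,
-- toℕ 1# ≡ 1.

record FiniteField (q : ℕ) : Set where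
  field
    _+_ _*_ : Fin q → Fin q → Fin q
    -_      : Fin q → Fin q
    0# 1#   : Fin q
    _⁻¹     : Fin q → Fin q
    isCommutativeRing : IsCommutativeRing _≡_ _+_ _*_ -_ 0# 1#
    0≢1     : 0# ≢ 1#
    ⁻¹-inverse : ∀ x → x ≢ 0# → x * (x ⁻¹) ≡ 1#
    enum-0  : toℕ 0# ≡ 0
    enum-1  : toℕ 1# ≡ 1

-- Polynomials over F_q: coefficient lists, lowest degree first
-- (f = c₀ + c₁ t + …). Trailing zero coefficients are allowed in the
-- raw representation; `norm` strips them, and the canonical polynomials
-- are those with `Canonical` (no trailing zero, so [] is the zero
-- polynomial).

Poly : ℕ → Set
Poly q = List (Fin q)

-- base-q digits of n (least significant first, no trailing zero digit);
-- fuel n suffices since q ≥ 2 for a field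
digits : (q : ℕ) → ℕ → List (Fin q)
digits zero _ = []
digits (suc k) n = go n n
  where
  go : ℕ → ℕ → List (Fin (suc k))
  go zero _ = []
  go (suc fuel) zero = []
  go (suc fuel) (suc m) = (suc m mod suc k) ∷ go fuel (suc m div suc k)

module PolyOps {q : ℕ} (F : FiniteField q) where
  open FiniteField F

  isZero : Fin q → Bool
  isZero c = ⌊ c Fin.≟ 0# ⌋

  norm : Poly q → Poly q
  norm [] = []
  norm (c ∷ cs) with norm cs
  ... | [] = if isZero c then [] else c ∷ []
  ... | d ∷ ds = c ∷ d ∷ ds

  Canonical : Poly q → Set
  Canonical f = norm f ≡ f

  _⊕_ : Poly q → Poly q → Poly q
  [] ⊕ g = g
  (c ∷ f) ⊕ [] = c ∷ f
  (c ∷ f) ⊕ (d ∷ g) = (c + d) ∷ (f ⊕ g)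

  ⊖_ : Poly q → Poly q
  ⊖ f = map -_ f

  _⊝_ : Poly q → Poly q → Poly q
  f ⊝ g = norm (f ⊕ (⊖ g))

  scale : Fin q → Poly q → Poly q
  scale c g = map (c *_) g

  _⊛_ : Poly q → Poly q → Poly q
  [] ⊛ g = []
  (c ∷ f) ⊛ g = norm (scale c g ⊕ (0# ∷ (f ⊛ g)))

  one : Poly q
  one = 1# ∷ []

  t t² : Poly q
  t = 0# ∷ 1# ∷ []
  t² = 0# ∷ 0# ∷ 1# ∷ []

  _∣ₚ_ : Poly q → Poly q → Set
  f ∣ₚ h = ∃ λ k → norm (k ⊛ f) ≡ norm h

  δ : Poly q → ℕ
  δ [] = 0
  δ (c ∷ cs) = toℕ c ℕ.+ q ℕ.* δ cs

  -- the inverse of δ: the canonical polynomial with δ = n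
  decode : ℕ → Poly q
  decode = digits q

  _<ₚ_ : Poly q → Poly q → Set
  f <ₚ g = δ f < δ g

  product : List (Poly q) → Poly q
  product = foldr _⊛_ one

  -- f! = ∏_{g < f} (f - g): the g < f are exactly decode n for n < δ f
  _!ₚ : Poly q → Poly q
  f !ₚ = product (map (λ n → f ⊝ decode n) (upTo (δ f)))

  IsS : Poly q → Poly q → Set
  IsS f g = (f ∣ₚ (g !ₚ)) × (∀ h → h <ₚ g → ¬ (f ∣ₚ (h !ₚ)))

-- S(f) = f means f ∣ f! and f ∤ h! for all h < f, and the first part always holds because f − 0 = f
-- is a factor of f!. So f fails to be a fixed point as soon as f ∣ h! for some h < f, and such an h
-- exists unless f ∈ {t, t²}: for a constant f take h = 0; for f = c + t r with c ≠ 0 take h = t r,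
-- since t r − (−c) = f; for f = c t with c ≠ 1 take h = t; for f = t g with g neither constant nor t
-- take h = g, whose factorial contains g and a factor g − m divisible by t; for f = t² and q > 2 take
-- h = a t with a ∉ {0, 1}. Conversely, for h < t no factor of h! is divisible by t, and for h < 2q at
-- most one factor is divisible by t and none by t²; as δ(t²) = q² = 2q when q = 2, t is always a fixed
-- point and t² is one when q = 2.
{-# OPTIONS --safe #-}
module Submission where

open import Defs
open import Data.Nat using (ℕ; _<_)
open import Data.Product using (_×_)
open import Data.Sum using (_⊎_)
open import Function.Bundles using (_⇔_)
open import Relation.Binary.PropositionalEquality using (_≡_; _≢_)
open import Data.List using ([])

open import Level using (0ℓ)
open import Data.Nat as ℕ using (zero; suc; _≤_; z≤n; s≤s)
import Data.Nat.Properties as ℕₚ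
open import Data.Nat.DivMod using (_%_; _/_; _mod_; m<n⇒m/n≡0; m<n⇒m%n≡m; n%n≡0; m≡m%n+[m/n]*n)
open import Data.Fin as Fin using (Fin; toℕ)
import Data.Fin.Properties as Finₚ
open import Data.Bool using (if_then_else_)
open import Data.Empty using (⊥-elim)
open import Data.List using (_∷_; applyUpTo; drop)
open import Data.List.Properties using (map-upTo)
open import Data.Product using (∃; _,_; proj₁)
open import Data.Sum as Sum using (inj₁; inj₂; [_,_]′)
open import Function using (_∘_; id)
open import Function.Bundles using (mk⇔)
open import Relation.Binary.PropositionalEquality
  using (refl; sym; trans; cong; cong₂; subst; subst₂; module ≡-Reasoning)
open import Relation.Binary.Bundles using (Setoid)
import Relation.Binary.Reasoning.Setoid as SetoidReasoning
open import Relation.Nullary using (¬_; yes; no)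
open import Algebra.Bundles using (CommutativeRing)
import Algebra.Properties.Ring as RingProperties
import Algebra.Properties.CommutativeSemigroup as CommutativeSemigroupProperties

module Polynomials {q : ℕ} (F : FiniteField q) where
  open FiniteField F using (_⁻¹; ⁻¹-inverse; 0≢1; isCommutativeRing)
  open PolyOps F

  commutativeRing : CommutativeRing 0ℓ 0ℓ
  commutativeRing = record { isCommutativeRing = isCommutativeRing }

  open CommutativeRing commutativeRing
    using (_+_; _*_; -_; 0#; 1#; +-identityˡ; +-identityʳ; *-assoc; *-comm; *-identityˡ; distribˡ; distribʳ; zeroˡ; zeroʳ)
  open RingProperties (CommutativeRing.ring commutativeRing)
    using (-0#≈0#)
  open CommutativeSemigroupProperties (CommutativeRing.+-commutativeSemigroup commutativeRing)
    using (interchange)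

  x*y≡0⇒y≡0 : ∀ {x y} → x ≢ 0# → x * y ≡ 0# → y ≡ 0#
  x*y≡0⇒y≡0 {x} {y} x≢0 xy≡0 = begin
    y                  ≡⟨ *-identityˡ y ⟨
    1# * y             ≡⟨ cong (_* y) (⁻¹-inverse x x≢0) ⟨
    (x * (x ⁻¹)) * y   ≡⟨ cong (_* y) (*-comm x (x ⁻¹)) ⟩
    ((x ⁻¹) * x) * y   ≡⟨ *-assoc (x ⁻¹) x y ⟩
    (x ⁻¹) * (x * y)   ≡⟨ cong ((x ⁻¹) *_) xy≡0 ⟩
    (x ⁻¹) * 0#        ≡⟨ zeroʳ (x ⁻¹) ⟩
    0#                 ∎
    where open ≡-Reasoning

  coeff : Poly q → ℕ → Fin q
  coeff []      _       = 0#
  coeff (c ∷ f) zero    = c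
  coeff (c ∷ f) (suc i) = coeff f i

  infix 4 _≈_
  record _≈_ (f g : Poly q) : Set where
    constructor mk≈
    field at : ∀ i → coeff f i ≡ coeff g i
  open _≈_ public

  ≈-refl : ∀ {f} → f ≈ f
  ≈-refl = mk≈ λ _ → refl

  ≈-sym : ∀ {f g} → f ≈ g → g ≈ f
  ≈-sym p = mk≈ λ i → sym (at p i)

  ≈-trans : ∀ {f g h} → f ≈ g → g ≈ h → f ≈ h
  ≈-trans p r = mk≈ λ i → trans (at p i) (at r i)

  ≈-setoid : Setoid 0ℓ 0ℓ
  ≈-setoid = record
    { Carrier = Poly q ; _≈_ = _≈_
    ; isEquivalence = record { refl = ≈-refl ; sym = ≈-sym ; trans = ≈-trans } }

  module ≈-Reasoning = SetoidReasoning ≈-setoid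

  ∷-cong : ∀ {c d f g} → c ≡ d → f ≈ g → c ∷ f ≈ d ∷ g
  ∷-cong c≡d p = mk≈ λ { zero → c≡d ; (suc i) → at p i }

  ∷≈[] : ∀ {c f} → c ≡ 0# → f ≈ [] → c ∷ f ≈ []
  ∷≈[] c≡0 p = mk≈ λ { zero → c≡0 ; (suc i) → at p i }

  ∷-≈-tail : ∀ {c d f g} → c ∷ f ≈ d ∷ g → f ≈ g
  ∷-≈-tail p = mk≈ λ i → at p (suc i)

  ∷≈[]-tail : ∀ {c f} → c ∷ f ≈ [] → f ≈ []
  ∷≈[]-tail p = mk≈ λ i → at p (suc i)

  consNorm : Fin q → Poly q → Poly q
  consNorm c []       = if isZero c then [] else c ∷ []
  consNorm c (d ∷ ds) = c ∷ d ∷ ds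

  norm-∷ : ∀ c f → norm (c ∷ f) ≡ consNorm c (norm f)
  norm-∷ c f with norm f
  ... | []     = refl
  ... | _ ∷ _  = refl

  consNorm-≈ : ∀ c f → consNorm c f ≈ c ∷ f
  consNorm-≈ c (d ∷ ds) = ≈-refl
  consNorm-≈ c [] with c Fin.≟ 0#
  ... | yes c≡0 = ≈-sym (∷≈[] c≡0 ≈-refl)
  ... | no  _   = ≈-refl

  consNorm-0# : ∀ {c} → c ≡ 0# → consNorm c [] ≡ []
  consNorm-0# {c} c≡0 with c Fin.≟ 0#
  ... | yes _   = refl
  ... | no c≢0 = ⊥-elim (c≢0 c≡0)

  norm-≈ : ∀ f → norm f ≈ f
  norm-≈ []      = ≈-refl
  norm-≈ (c ∷ f) rewrite norm-∷ c f = ≈-trans (consNorm-≈ c (norm f)) (∷-cong refl (norm-≈ f))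

  ≈[]⇒norm≡[] : ∀ f → f ≈ [] → norm f ≡ []
  ≈[]⇒norm≡[] []      _ = refl
  ≈[]⇒norm≡[] (c ∷ f) p rewrite norm-∷ c f | ≈[]⇒norm≡[] f (∷≈[]-tail p) = consNorm-0# (at p 0)

  ≈⇒norm≡ : ∀ f g → f ≈ g → norm f ≡ norm g
  ≈⇒norm≡ []      g       p = sym (≈[]⇒norm≡[] g (≈-sym p))
  ≈⇒norm≡ (c ∷ f) []      p = ≈[]⇒norm≡[] (c ∷ f) p
  ≈⇒norm≡ (c ∷ f) (d ∷ g) p
    rewrite norm-∷ c f | norm-∷ d g | at p 0 | ≈⇒norm≡ f g (∷-≈-tail p) = refl

  canonical-[c] : ∀ {c} → Canonical (c ∷ []) → c ≢ 0#
  canonical-[c] {c} can c≡0 with c Fin.≟ 0#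
  canonical-[c] () c≡0 | yes _
  ... | no c≢0 = c≢0 c≡0

  canonical-tail : ∀ {c d r} → Canonical (c ∷ d ∷ r) → Canonical (d ∷ r)
  canonical-tail {c} {d} {r} can with norm (d ∷ r)
  ... | x ∷ xs = cong (λ { (_ ∷ ys) → ys ; [] → [] }) can
  ... | [] with c Fin.≟ 0#
  canonical-tail () | [] | yes _
  canonical-tail () | [] | no _

  -- Coefficientwise ring laws

  coeff-⊕ : ∀ f g i → coeff (f ⊕ g) i ≡ coeff f i + coeff g i
  coeff-⊕ []      g       i       = sym (+-identityˡ _)
  coeff-⊕ (c ∷ f) []      i       = sym (+-identityʳ _)
  coeff-⊕ (c ∷ f) (d ∷ g) zero    = refl
  coeff-⊕ (c ∷ f) (d ∷ g) (suc i) = coeff-⊕ f g i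

  coeff-⊖ : ∀ f i → coeff (⊖ f) i ≡ - coeff f i
  coeff-⊖ []      i       = sym -0#≈0#
  coeff-⊖ (c ∷ f) zero    = refl
  coeff-⊖ (c ∷ f) (suc i) = coeff-⊖ f i

  coeff-⊝ : ∀ f g i → coeff (f ⊝ g) i ≡ coeff f i + - coeff g i
  coeff-⊝ f g i = trans (at (norm-≈ (f ⊕ (⊖ g))) i) (trans (coeff-⊕ f (⊖ g) i) (cong (coeff f i +_) (coeff-⊖ g i)))

  coeff-scale : ∀ c f i → coeff (scale c f) i ≡ c * coeff f i
  coeff-scale c []      i       = sym (zeroʳ c)
  coeff-scale c (d ∷ f) zero    = refl
  coeff-scale c (d ∷ f) (suc i) = coeff-scale c f i

  ⊕-cong : ∀ {f f′ g g′} → f ≈ f′ → g ≈ g′ → f ⊕ g ≈ f′ ⊕ g′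
  ⊕-cong {f} {f′} {g} {g′} p r = mk≈ λ i → begin
    coeff (f ⊕ g) i           ≡⟨ coeff-⊕ f g i ⟩
    coeff f i + coeff g i     ≡⟨ cong₂ _+_ (at p i) (at r i) ⟩
    coeff f′ i + coeff g′ i   ≡⟨ coeff-⊕ f′ g′ i ⟨
    coeff (f′ ⊕ g′) i         ∎
    where open ≡-Reasoning

  ⊖-cong : ∀ {f g} → f ≈ g → ⊖ f ≈ ⊖ g
  ⊖-cong {f} {g} p = mk≈ λ i → trans (coeff-⊖ f i) (trans (cong -_ (at p i)) (sym (coeff-⊖ g i)))

  scale-cong : ∀ {c d f g} → c ≡ d → f ≈ g → scale c f ≈ scale d g
  scale-cong {c} {d} {f} {g} c≡d p = mk≈ λ i →
    trans (coeff-scale c f i) (trans (cong₂ _*_ c≡d (at p i)) (sym (coeff-scale d g i)))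

  ⊕-identityʳ : ∀ f → f ⊕ [] ≈ f
  ⊕-identityʳ f = mk≈ λ i → trans (coeff-⊕ f [] i) (+-identityʳ _)

  ⊕-interchange : ∀ f g h k → (f ⊕ g) ⊕ (h ⊕ k) ≈ (f ⊕ h) ⊕ (g ⊕ k)
  ⊕-interchange f g h k = mk≈ λ i → begin
    coeff ((f ⊕ g) ⊕ (h ⊕ k)) i                           ≡⟨ coeff-⊕ (f ⊕ g) (h ⊕ k) i ⟩
    coeff (f ⊕ g) i + coeff (h ⊕ k) i                     ≡⟨ cong₂ _+_ (coeff-⊕ f g i) (coeff-⊕ h k i) ⟩
    (coeff f i + coeff g i) + (coeff h i + coeff k i)     ≡⟨ interchange _ _ _ _ ⟩
    (coeff f i + coeff h i) + (coeff g i + coeff k i)     ≡⟨ cong₂ _+_ (coeff-⊕ f h i) (coeff-⊕ g k i) ⟨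
    coeff (f ⊕ h) i + coeff (g ⊕ k) i                     ≡⟨ coeff-⊕ (f ⊕ h) (g ⊕ k) i ⟨
    coeff ((f ⊕ h) ⊕ (g ⊕ k)) i                           ∎
    where open ≡-Reasoning

  scale-zeroˡ : ∀ {c} → c ≡ 0# → ∀ f → scale c f ≈ []
  scale-zeroˡ {c} c≡0 f = mk≈ λ i → trans (coeff-scale c f i) (trans (cong (_* coeff f i) c≡0) (zeroˡ _))

  scale-identityˡ : ∀ f → scale 1# f ≈ f
  scale-identityˡ f = mk≈ λ i → trans (coeff-scale 1# f i) (*-identityˡ _)

  scale-assoc : ∀ c d f → scale (c * d) f ≈ scale c (scale d f)
  scale-assoc c d f = mk≈ λ i → begin
    coeff (scale (c * d) f) i     ≡⟨ coeff-scale (c * d) f i ⟩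
    (c * d) * coeff f i           ≡⟨ *-assoc c d _ ⟩
    c * (d * coeff f i)           ≡⟨ cong (c *_) (coeff-scale d f i) ⟨
    c * coeff (scale d f) i       ≡⟨ coeff-scale c (scale d f) i ⟨
    coeff (scale c (scale d f)) i ∎
    where open ≡-Reasoning

  scale-distribʳ : ∀ c d f → scale (c + d) f ≈ scale c f ⊕ scale d f
  scale-distribʳ c d f = mk≈ λ i → begin
    coeff (scale (c + d) f) i                     ≡⟨ coeff-scale (c + d) f i ⟩
    (c + d) * coeff f i                           ≡⟨ distribʳ _ c d ⟩
    c * coeff f i + d * coeff f i                 ≡⟨ cong₂ _+_ (coeff-scale c f i) (coeff-scale d f i) ⟨
    coeff (scale c f) i + coeff (scale d f) i     ≡⟨ coeff-⊕ (scale c f) (scale d f) i ⟨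
    coeff (scale c f ⊕ scale d f) i               ∎
    where open ≡-Reasoning

  scale-distribˡ : ∀ c f g → scale c (f ⊕ g) ≈ scale c f ⊕ scale c g
  scale-distribˡ c f g = mk≈ λ i → begin
    coeff (scale c (f ⊕ g)) i                     ≡⟨ coeff-scale c (f ⊕ g) i ⟩
    c * coeff (f ⊕ g) i                           ≡⟨ cong (c *_) (coeff-⊕ f g i) ⟩
    c * (coeff f i + coeff g i)                   ≡⟨ distribˡ c _ _ ⟩
    c * coeff f i + c * coeff g i                 ≡⟨ cong₂ _+_ (coeff-scale c f i) (coeff-scale c g i) ⟨
    coeff (scale c f) i + coeff (scale c g) i     ≡⟨ coeff-⊕ (scale c f) (scale c g) i ⟨
    coeff (scale c f ⊕ scale c g) i               ∎
    where open ≡-Reasoning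

  ⊛-∷ : ∀ c f g → (c ∷ f) ⊛ g ≈ scale c g ⊕ (0# ∷ (f ⊛ g))
  ⊛-∷ c f g = norm-≈ _

  ⊛-zeroˡ : ∀ {f} g → f ≈ [] → f ⊛ g ≈ []
  ⊛-zeroˡ {[]}    g p = ≈-refl
  ⊛-zeroˡ {c ∷ f} g p =
    ≈-trans (⊛-∷ c f g) (⊕-cong (scale-zeroˡ (at p 0) g) (∷≈[] refl (⊛-zeroˡ g (∷≈[]-tail p))))

  ⊛-zeroʳ : ∀ f → f ⊛ [] ≈ []
  ⊛-zeroʳ []      = ≈-refl
  ⊛-zeroʳ (c ∷ f) = ≈-trans (⊛-∷ c f []) (∷≈[] refl (⊛-zeroʳ f))

  ⊛-congˡ : ∀ {f f′} g → f ≈ f′ → f ⊛ g ≈ f′ ⊛ g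
  ⊛-congˡ {[]}    {f′}      g p = ≈-sym (⊛-zeroˡ g (≈-sym p))
  ⊛-congˡ {c ∷ f} {[]}      g p = ⊛-zeroˡ g p
  ⊛-congˡ {c ∷ f} {c′ ∷ f′} g p = begin
    (c ∷ f) ⊛ g                    ≈⟨ ⊛-∷ c f g ⟩
    scale c g ⊕ (0# ∷ (f ⊛ g))     ≈⟨ ⊕-cong (scale-cong (at p 0) ≈-refl) (∷-cong refl (⊛-congˡ g (∷-≈-tail p))) ⟩
    scale c′ g ⊕ (0# ∷ (f′ ⊛ g))   ≈⟨ ⊛-∷ c′ f′ g ⟨
    (c′ ∷ f′) ⊛ g                  ∎
    where open ≈-Reasoning

  ⊛-congʳ : ∀ f {g g′} → g ≈ g′ → f ⊛ g ≈ f ⊛ g′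
  ⊛-congʳ []      p = ≈-refl
  ⊛-congʳ (c ∷ f) {g} {g′} p = begin
    (c ∷ f) ⊛ g                    ≈⟨ ⊛-∷ c f g ⟩
    scale c g ⊕ (0# ∷ (f ⊛ g))     ≈⟨ ⊕-cong (scale-cong refl p) (∷-cong refl (⊛-congʳ f p)) ⟩
    scale c g′ ⊕ (0# ∷ (f ⊛ g′))   ≈⟨ ⊛-∷ c f g′ ⟨
    (c ∷ f) ⊛ g′                   ∎
    where open ≈-Reasoning

  ⊛-[c]ˡ : ∀ c f → (c ∷ []) ⊛ f ≈ scale c f
  ⊛-[c]ˡ c f = ≈-trans (⊛-∷ c [] f) (≈-trans (⊕-cong ≈-refl (∷≈[] refl ≈-refl)) (⊕-identityʳ (scale c f)))

  ⊛-identityˡ : ∀ f → one ⊛ f ≈ f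
  ⊛-identityˡ f = ≈-trans (⊛-[c]ˡ 1# f) (scale-identityˡ f)

  ⊛-[c]ʳ : ∀ f c → f ⊛ (c ∷ []) ≈ scale c f
  ⊛-[c]ʳ []      c = ≈-refl
  ⊛-[c]ʳ (d ∷ f) c =
    ≈-trans (⊛-∷ d f (c ∷ [])) (∷-cong (trans (+-identityʳ _) (*-comm d c)) (⊛-[c]ʳ f c))

  ⊛-0∷ˡ : ∀ f g → (0# ∷ f) ⊛ g ≈ 0# ∷ (f ⊛ g)
  ⊛-0∷ˡ f g = ≈-trans (⊛-∷ 0# f g) (⊕-cong (scale-zeroˡ refl g) ≈-refl)

  ⊛-0∷ʳ : ∀ f g → f ⊛ (0# ∷ g) ≈ 0# ∷ (f ⊛ g)
  ⊛-0∷ʳ []      g = ≈-sym (∷≈[] refl ≈-refl)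
  ⊛-0∷ʳ (c ∷ f) g = begin
    (c ∷ f) ⊛ (0# ∷ g)                              ≈⟨ ⊛-∷ c f (0# ∷ g) ⟩
    ((c * 0#) + 0#) ∷ (scale c g ⊕ (f ⊛ (0# ∷ g)))   ≈⟨ ∷-cong (trans (+-identityʳ _) (zeroʳ c)) (⊕-cong ≈-refl (⊛-0∷ʳ f g)) ⟩
    0# ∷ (scale c g ⊕ (0# ∷ (f ⊛ g)))               ≈⟨ ∷-cong refl (⊛-∷ c f g) ⟨
    0# ∷ ((c ∷ f) ⊛ g)                              ∎
    where open ≈-Reasoning

  ⊛-distribʳ : ∀ f g h → (f ⊕ g) ⊛ h ≈ (f ⊛ h) ⊕ (g ⊛ h)
  ⊛-distribʳ []      g       h = ≈-refl
  ⊛-distribʳ (c ∷ f) []      h = ≈-sym (⊕-identityʳ _)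
  ⊛-distribʳ (c ∷ f) (d ∷ g) h = begin
    ((c + d) ∷ (f ⊕ g)) ⊛ h
      ≈⟨ ⊛-∷ (c + d) (f ⊕ g) h ⟩
    scale (c + d) h ⊕ (0# ∷ ((f ⊕ g) ⊛ h))
      ≈⟨ ⊕-cong (scale-distribʳ c d h) (∷-cong (sym (+-identityˡ 0#)) (⊛-distribʳ f g h)) ⟩
    (scale c h ⊕ scale d h) ⊕ ((0# ∷ (f ⊛ h)) ⊕ (0# ∷ (g ⊛ h)))
      ≈⟨ ⊕-interchange (scale c h) (scale d h) (0# ∷ (f ⊛ h)) (0# ∷ (g ⊛ h)) ⟩
    (scale c h ⊕ (0# ∷ (f ⊛ h))) ⊕ (scale d h ⊕ (0# ∷ (g ⊛ h)))
      ≈⟨ ⊕-cong (⊛-∷ c f h) (⊛-∷ d g h) ⟨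
    ((c ∷ f) ⊛ h) ⊕ ((d ∷ g) ⊛ h)
      ∎
    where open ≈-Reasoning

  ⊛-distribˡ : ∀ f g h → f ⊛ (g ⊕ h) ≈ (f ⊛ g) ⊕ (f ⊛ h)
  ⊛-distribˡ []      g h = ≈-refl
  ⊛-distribˡ (c ∷ f) g h = begin
    (c ∷ f) ⊛ (g ⊕ h)
      ≈⟨ ⊛-∷ c f (g ⊕ h) ⟩
    scale c (g ⊕ h) ⊕ (0# ∷ (f ⊛ (g ⊕ h)))
      ≈⟨ ⊕-cong (scale-distribˡ c g h) (∷-cong (sym (+-identityˡ 0#)) (⊛-distribˡ f g h)) ⟩
    (scale c g ⊕ scale c h) ⊕ ((0# ∷ (f ⊛ g)) ⊕ (0# ∷ (f ⊛ h)))
      ≈⟨ ⊕-interchange (scale c g) (scale c h) (0# ∷ (f ⊛ g)) (0# ∷ (f ⊛ h)) ⟩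
    (scale c g ⊕ (0# ∷ (f ⊛ g))) ⊕ (scale c h ⊕ (0# ∷ (f ⊛ h)))
      ≈⟨ ⊕-cong (⊛-∷ c f g) (⊛-∷ c f h) ⟨
    ((c ∷ f) ⊛ g) ⊕ ((c ∷ f) ⊛ h)
      ∎
    where open ≈-Reasoning

  ⊛-comm : ∀ f g → f ⊛ g ≈ g ⊛ f
  ⊛-comm []      g = ≈-sym (⊛-zeroʳ g)
  ⊛-comm (c ∷ f) g = begin
    (c ∷ f) ⊛ g                          ≈⟨ ⊛-∷ c f g ⟩
    scale c g ⊕ (0# ∷ (f ⊛ g))           ≈⟨ ⊕-cong (⊛-[c]ʳ g c) (≈-trans (⊛-0∷ʳ g f) (∷-cong refl (⊛-comm g f))) ⟨
    (g ⊛ (c ∷ [])) ⊕ (g ⊛ (0# ∷ f))      ≈⟨ ⊛-distribˡ g (c ∷ []) (0# ∷ f) ⟨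
    g ⊛ ((c + 0#) ∷ f)                   ≈⟨ ⊛-congʳ g (∷-cong (+-identityʳ c) ≈-refl) ⟩
    g ⊛ (c ∷ f)                          ∎
    where open ≈-Reasoning

  scale-⊛ : ∀ c f g → scale c f ⊛ g ≈ scale c (f ⊛ g)
  scale-⊛ c []      g = ≈-refl
  scale-⊛ c (d ∷ f) g = begin
    ((c * d) ∷ scale c f) ⊛ g
      ≈⟨ ⊛-∷ (c * d) (scale c f) g ⟩
    scale (c * d) g ⊕ (0# ∷ (scale c f ⊛ g))
      ≈⟨ ⊕-cong (scale-assoc c d g) (∷-cong (sym (zeroʳ c)) (scale-⊛ c f g)) ⟩
    scale c (scale d g) ⊕ scale c (0# ∷ (f ⊛ g))
      ≈⟨ scale-distribˡ c (scale d g) (0# ∷ (f ⊛ g)) ⟨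
    scale c (scale d g ⊕ (0# ∷ (f ⊛ g)))
      ≈⟨ scale-cong refl (⊛-∷ d f g) ⟨
    scale c ((d ∷ f) ⊛ g)
      ∎
    where open ≈-Reasoning

  ⊛-assoc : ∀ f g h → (f ⊛ g) ⊛ h ≈ f ⊛ (g ⊛ h)
  ⊛-assoc []      g h = ≈-refl
  ⊛-assoc (c ∷ f) g h = begin
    ((c ∷ f) ⊛ g) ⊛ h
      ≈⟨ ⊛-congˡ h (⊛-∷ c f g) ⟩
    (scale c g ⊕ (0# ∷ (f ⊛ g))) ⊛ h
      ≈⟨ ⊛-distribʳ (scale c g) (0# ∷ (f ⊛ g)) h ⟩
    (scale c g ⊛ h) ⊕ ((0# ∷ (f ⊛ g)) ⊛ h)
      ≈⟨ ⊕-cong (scale-⊛ c g h) (≈-trans (⊛-0∷ˡ (f ⊛ g) h) (∷-cong refl (⊛-assoc f g h))) ⟩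
    scale c (g ⊛ h) ⊕ (0# ∷ (f ⊛ (g ⊛ h)))
      ≈⟨ ⊛-∷ c f (g ⊛ h) ⟨
    (c ∷ f) ⊛ (g ⊛ h)
      ∎
    where open ≈-Reasoning

  infix 4 _∣_
  _∣_ : Poly q → Poly q → Set
  a ∣ P = ∃ λ k → k ⊛ a ≈ P

  ∣ₚ⇒∣ : ∀ {a P} → a ∣ₚ P → a ∣ P
  ∣ₚ⇒∣ {a} {P} (k , eq) = k , (begin
    k ⊛ a          ≈⟨ norm-≈ (k ⊛ a) ⟨
    norm (k ⊛ a)   ≡⟨ eq ⟩
    norm P         ≈⟨ norm-≈ P ⟩
    P              ∎)
    where open ≈-Reasoning

  ∣⇒∣ₚ : ∀ {a P} → a ∣ P → a ∣ₚ P
  ∣⇒∣ₚ {a} {P} (k , p) = k , ≈⇒norm≡ (k ⊛ a) P p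

  ∣-respʳ : ∀ {a P P′} → P ≈ P′ → a ∣ P → a ∣ P′
  ∣-respʳ p (k , r) = k , ≈-trans r p

  ∣-respˡ : ∀ {a a′ P} → a ≈ a′ → a ∣ P → a′ ∣ P
  ∣-respˡ p (k , r) = k , ≈-trans (⊛-congʳ k (≈-sym p)) r

  ∣-refl : ∀ {a} → a ∣ a
  ∣-refl {a} = one , ⊛-identityˡ a

  ∣-⊛ʳ : ∀ {a} x {y} → a ∣ y → a ∣ x ⊛ y
  ∣-⊛ʳ {a} x (k , p) = x ⊛ k , ≈-trans (⊛-assoc x k a) (⊛-congʳ x p)

  ∣-⊛ˡ : ∀ {a x} y → a ∣ x → a ∣ x ⊛ y
  ∣-⊛ˡ {x = x} y a∣x = ∣-respʳ (⊛-comm y x) (∣-⊛ʳ y a∣x)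

  ⊛-mono-∣ : ∀ {a b x y} → a ∣ x → b ∣ y → a ⊛ b ∣ x ⊛ y
  ⊛-mono-∣ {a} {b} {x} {y} (k , p) (l , r) = k ⊛ l , (begin
    (k ⊛ l) ⊛ (a ⊛ b)   ≈⟨ ⊛-assoc k l (a ⊛ b) ⟩
    k ⊛ (l ⊛ (a ⊛ b))   ≈⟨ ⊛-congʳ k (⊛-assoc l a b) ⟨
    k ⊛ ((l ⊛ a) ⊛ b)   ≈⟨ ⊛-congʳ k (⊛-congˡ b (⊛-comm l a)) ⟩
    k ⊛ ((a ⊛ l) ⊛ b)   ≈⟨ ⊛-congʳ k (⊛-assoc a l b) ⟩
    k ⊛ (a ⊛ (l ⊛ b))   ≈⟨ ⊛-assoc k a (l ⊛ b) ⟨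
    (k ⊛ a) ⊛ (l ⊛ b)   ≈⟨ ⊛-congʳ (k ⊛ a) r ⟩
    (k ⊛ a) ⊛ y         ≈⟨ ⊛-congˡ y p ⟩
    x ⊛ y               ∎)
    where open ≈-Reasoning

  scale-∣ : ∀ {c} u → c ≢ 0# → scale c u ∣ u
  scale-∣ {c} u c≢0 = (c ⁻¹) ∷ [] , (begin
    ((c ⁻¹) ∷ []) ⊛ scale c u   ≈⟨ ⊛-[c]ˡ (c ⁻¹) (scale c u) ⟩
    scale (c ⁻¹) (scale c u)    ≈⟨ scale-assoc (c ⁻¹) c u ⟨
    scale ((c ⁻¹) * c) u        ≈⟨ scale-cong (trans (*-comm (c ⁻¹) c) (⁻¹-inverse c c≢0)) ≈-refl ⟩
    scale 1# u                  ≈⟨ scale-identityˡ u ⟩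
    u                           ∎)
    where open ≈-Reasoning

  ∣-product : ∀ {a} ψ {n N} → n < N → a ∣ ψ n → a ∣ product (applyUpTo ψ N)
  ∣-product ψ {zero}  {suc N} _          a∣ψn = ∣-⊛ˡ _ a∣ψn
  ∣-product ψ {suc n} {suc N} (s≤s n<N) a∣ψn = ∣-⊛ʳ (ψ 0) (∣-product (ψ ∘ suc) n<N a∣ψn)

  ⊛-∣-product : ∀ {a b} ψ {n N} → suc n < N → a ∣ ψ 0 → b ∣ ψ (suc n) →
                a ⊛ b ∣ product (applyUpTo ψ N)
  ⊛-∣-product ψ {N = suc N} (s≤s n<N) a∣ψ₀ b∣ψₙ = ⊛-mono-∣ a∣ψ₀ (∣-product (ψ ∘ suc) n<N b∣ψₙ)

  -- Divisibility by t and t², read off the two lowest coefficients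

  ⊛-t : ∀ g → g ⊛ t ≈ 0# ∷ g
  ⊛-t g = ≈-trans (⊛-comm g t) (≈-trans (⊛-0∷ˡ one g) (∷-cong refl (⊛-identityˡ g)))

  coeff₀-⊛ : ∀ f g → coeff (f ⊛ g) 0 ≡ coeff f 0 * coeff g 0
  coeff₀-⊛ []      g = sym (zeroˡ _)
  coeff₀-⊛ (c ∷ f) g = begin
    coeff ((c ∷ f) ⊛ g) 0                    ≡⟨ at (⊛-∷ c f g) 0 ⟩
    coeff (scale c g ⊕ (0# ∷ (f ⊛ g))) 0     ≡⟨ coeff-⊕ (scale c g) (0# ∷ (f ⊛ g)) 0 ⟩
    coeff (scale c g) 0 + 0#                 ≡⟨ +-identityʳ _ ⟩
    coeff (scale c g) 0                      ≡⟨ coeff-scale c g 0 ⟩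
    c * coeff g 0                            ∎
    where open ≡-Reasoning

  coeff₁-⊛ : ∀ f g → coeff (f ⊛ g) 1 ≡ coeff f 0 * coeff g 1 + coeff f 1 * coeff g 0
  coeff₁-⊛ []      g = sym (trans (cong₂ _+_ (zeroˡ _) (zeroˡ _)) (+-identityˡ 0#))
  coeff₁-⊛ (c ∷ f) g = begin
    coeff ((c ∷ f) ⊛ g) 1                    ≡⟨ at (⊛-∷ c f g) 1 ⟩
    coeff (scale c g ⊕ (0# ∷ (f ⊛ g))) 1     ≡⟨ coeff-⊕ (scale c g) (0# ∷ (f ⊛ g)) 1 ⟩
    coeff (scale c g) 1 + coeff (f ⊛ g) 0    ≡⟨ cong₂ _+_ (coeff-scale c g 1) (coeff₀-⊛ f g) ⟩
    c * coeff g 1 + coeff f 0 * coeff g 0    ∎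
    where open ≡-Reasoning

  coeff₀≡0⇒t∣ : ∀ {P} → coeff P 0 ≡ 0# → t ∣ P
  coeff₀≡0⇒t∣ {[]}    _    = [] , ≈-refl
  coeff₀≡0⇒t∣ {c ∷ P} c≡0 = P , ≈-trans (⊛-t P) (∷-cong (sym c≡0) ≈-refl)

  t∣⇒coeff₀≡0 : ∀ {P} → t ∣ P → coeff P 0 ≡ 0#
  t∣⇒coeff₀≡0 (k , p) = trans (sym (at p 0)) (at (⊛-t k) 0)

  t²∣⇒coeff₀₁≡0 : ∀ {P} → t² ∣ P → coeff P 0 ≡ 0# × coeff P 1 ≡ 0#
  t²∣⇒coeff₀₁≡0 (k , p) = trans (sym (at p 0)) (at k⊛t² 0) , trans (sym (at p 1)) (at k⊛t² 1)
    where
    k⊛t² : k ⊛ t² ≈ 0# ∷ 0# ∷ k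
    k⊛t² = ≈-trans (⊛-0∷ʳ k t) (∷-cong refl (⊛-t k))

  t∤_ : Poly q → Set
  t∤ P = coeff P 0 ≢ 0#

  t²∤_ : Poly q → Set
  t²∤ P = ¬ (coeff P 0 ≡ 0# × coeff P 1 ≡ 0#)

  t∤-⊛ : ∀ f g → t∤ f → t∤ g → t∤ (f ⊛ g)
  t∤-⊛ f g t∤f t∤g fg₀≡0 = t∤g (x*y≡0⇒y≡0 t∤f (trans (sym (coeff₀-⊛ f g)) fg₀≡0))

  t∤-⊛-t²∤ : ∀ f g → t∤ f → t²∤ g → t²∤ (f ⊛ g)
  t∤-⊛-t²∤ f g t∤f t²∤g (fg₀≡0 , fg₁≡0) = t²∤g (g₀≡0 , g₁≡0)
    where
    g₀≡0 : coeff g 0 ≡ 0#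
    g₀≡0 = x*y≡0⇒y≡0 t∤f (trans (sym (coeff₀-⊛ f g)) fg₀≡0)
    g₁≡0 : coeff g 1 ≡ 0#
    g₁≡0 = x*y≡0⇒y≡0 t∤f (begin
      coeff f 0 * coeff g 1                           ≡⟨ +-identityʳ _ ⟨
      coeff f 0 * coeff g 1 + 0#                      ≡⟨ cong (coeff f 0 * coeff g 1 +_) (trans (cong (coeff f 1 *_) g₀≡0) (zeroʳ _)) ⟨
      coeff f 0 * coeff g 1 + coeff f 1 * coeff g 0   ≡⟨ coeff₁-⊛ f g ⟨
      coeff (f ⊛ g) 1                                 ≡⟨ fg₁≡0 ⟩
      0#                                              ∎)
      where open ≡-Reasoning

  t²∤-⊛-t∤ : ∀ f g → t²∤ f → t∤ g → t²∤ (f ⊛ g)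
  t²∤-⊛-t∤ f g t²∤f t∤g (fg₀≡0 , fg₁≡0) =
    t∤-⊛-t²∤ g f t∤g t²∤f (trans (at (⊛-comm g f) 0) fg₀≡0 , trans (at (⊛-comm g f) 1) fg₁≡0)

  t∤one : t∤ one
  t∤one 1≡0 = 0≢1 (sym 1≡0)

  t∤-product : ∀ ψ N → (∀ n → n < N → t∤ ψ n) → t∤ product (applyUpTo ψ N)
  t∤-product ψ zero    _       = t∤one
  t∤-product ψ (suc N) t∤ψ = t∤-⊛ (ψ 0) _ (t∤ψ 0 ℕ.z<s) (t∤-product (ψ ∘ suc) N λ n n<N → t∤ψ (suc n) (s≤s n<N))

  t²∤-product : ∀ ψ N m → (∀ n → n < N → n ≢ m → t∤ ψ n) → (m < N → t²∤ ψ m) →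
                t²∤ product (applyUpTo ψ N)
  t²∤-product ψ zero    m       _   _    (1≡0 , _) = t∤one 1≡0
  t²∤-product ψ (suc N) zero    t∤ψ t²∤ψ =
    t²∤-⊛-t∤ (ψ 0) _ (t²∤ψ ℕ.z<s) (t∤-product (ψ ∘ suc) N λ n n<N → t∤ψ (suc n) (s≤s n<N) λ ())
  t²∤-product ψ (suc N) (suc m) t∤ψ t²∤ψ =
    t∤-⊛-t²∤ (ψ 0) _ (t∤ψ 0 ℕ.z<s λ ())
             (t²∤-product (ψ ∘ suc) N m (λ n n<N n≢m → t∤ψ (suc n) (s≤s n<N) (n≢m ∘ ℕₚ.suc-injective))
                                        (λ m<N → t²∤ψ (s≤s m<N)))

module FixedPoints (k : ℕ) (F : FiniteField (suc (suc k))) where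
  q : ℕ
  q = suc (suc k)

  open FiniteField F using (enum-0; enum-1; 0≢1)
  open PolyOps F
  open Polynomials F
  open CommutativeRing commutativeRing using (_+_; -_; 0#; 1#; +-identityˡ; -‿inverseʳ; zeroʳ; *-identityʳ)
  open RingProperties (CommutativeRing.ring commutativeRing) using (-‿involutive; x∙y⁻¹≈ε⇒x≈y)

  toℕ≡0⇒≡0# : ∀ {c} → toℕ c ≡ 0 → c ≡ 0#
  toℕ≡0⇒≡0# e = Finₚ.toℕ-injective (trans e (sym enum-0))

  toℕ≡1⇒≡1# : ∀ {c} → toℕ c ≡ 1 → c ≡ 1#
  toℕ≡1⇒≡1# e = Finₚ.toℕ-injective (trans e (sym enum-1))

  0<toℕ : ∀ {c} → c ≢ 0# → 0 < toℕ c
  0<toℕ c≢0 = ℕₚ.n≢0⇒n>0 (c≢0 ∘ toℕ≡0⇒≡0#)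

  1<toℕ : ∀ {c} → c ≢ 0# → c ≢ 1# → 1 < toℕ c
  1<toℕ {c} c≢0 c≢1 with toℕ c in eq
  ... | zero          = ⊥-elim (c≢0 (toℕ≡0⇒≡0# eq))
  ... | suc zero      = ⊥-elim (c≢1 (toℕ≡1⇒≡1# eq))
  ... | suc (suc _)   = s≤s (s≤s z≤n)

  q≤q*n : ∀ {n} → 0 < n → q ≤ q ℕ.* n
  q≤q*n {suc n} _ = ℕₚ.m≤m*n q (suc n)

  n<q*n : ∀ {n} → 0 < n → n < q ℕ.* n
  n<q*n {suc n} _ = subst (suc n <_) (ℕₚ.*-comm (suc n) q) (ℕₚ.m<m*n (suc n) q (s≤s (s≤s z≤n)))

  δ-[c] : ∀ c → δ (c ∷ []) ≡ toℕ c
  δ-[c] c = trans (cong (toℕ c ℕ.+_) (ℕₚ.*-zeroʳ q)) (ℕₚ.+-identityʳ (toℕ c))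

  δ-0∷ : ∀ g → δ (0# ∷ g) ≡ q ℕ.* δ g
  δ-0∷ g = cong (ℕ._+ q ℕ.* δ g) enum-0

  δ-t : δ t ≡ q
  δ-t = trans (δ-0∷ (1# ∷ [])) (trans (cong (q ℕ.*_) (trans (δ-[c] 1#) enum-1)) (ℕₚ.*-identityʳ q))

  δ-t² : δ t² ≡ q ℕ.* q
  δ-t² = trans (δ-0∷ t) (cong (q ℕ.*_) δ-t)

  0<δt : 0 < δ t
  0<δt = subst (0 <_) (sym δ-t) (s≤s z≤n)

  δ-coeff₀ : ∀ h → δ h ≡ toℕ (coeff h 0) ℕ.+ q ℕ.* δ (drop 1 h)
  δ-coeff₀ []      = sym (cong₂ ℕ._+_ enum-0 (ℕₚ.*-zeroʳ q))
  δ-coeff₀ (c ∷ h) = refl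

  coeff-drop1 : ∀ h i → coeff (drop 1 h) i ≡ coeff h (suc i)
  coeff-drop1 []      i = refl
  coeff-drop1 (c ∷ h) i = refl

  toℕ-coeff₀ : ∀ h → δ h < q → toℕ (coeff h 0) ≡ δ h
  toℕ-coeff₀ h δh<q with δ (drop 1 h) | δ-coeff₀ h
  ... | zero  | δh≡ = sym (trans δh≡ (trans (cong (toℕ (coeff h 0) ℕ.+_) (ℕₚ.*-zeroʳ q)) (ℕₚ.+-identityʳ _)))
  ... | suc d | δh≡ = ⊥-elim (ℕₚ.<-irrefl refl (ℕₚ.<-≤-trans δh<q (begin
        q                                      ≤⟨ q≤q*n (s≤s z≤n) ⟩
        q ℕ.* suc d                            ≤⟨ ℕₚ.m≤n+m _ _ ⟩
        toℕ (coeff h 0) ℕ.+ q ℕ.* suc d        ≡⟨ δh≡ ⟨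
        δ h                                    ∎)))
    where open ℕₚ.≤-Reasoning

  δ-pos : ∀ {f} → Canonical f → f ≢ [] → 0 < δ f
  δ-pos {[]}         _   f≢[] = ⊥-elim (f≢[] refl)
  δ-pos {c ∷ []}     can _    = subst (0 <_) (sym (δ-[c] c)) (0<toℕ (canonical-[c] can))
  δ-pos {c ∷ d ∷ r}  can _    =
    ℕₚ.<-≤-trans (ℕₚ.<-≤-trans (δ-pos (canonical-tail can) λ ()) (ℕₚ.m≤n*m _ q)) (ℕₚ.m≤n+m _ (toℕ c))

  toℕ-coeff₀-decode : ∀ n → toℕ (coeff (decode n) 0) ≡ n % q
  toℕ-coeff₀-decode zero    = enum-0
  toℕ-coeff₀-decode (suc n) = Finₚ.toℕ-fromℕ< _

  mod≡fromℕ< : ∀ {n} (n<q : n < q) → n mod q ≡ Fin.fromℕ< n<q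
  mod≡fromℕ< n<q = Finₚ.toℕ-injective (trans (Finₚ.toℕ-fromℕ< _) (trans (m<n⇒m%n≡m n<q) (sym (Finₚ.toℕ-fromℕ< n<q))))

  decode-digit : ∀ {n} (n<q : n < q) → decode n ≈ Fin.fromℕ< n<q ∷ []
  decode-digit {zero}  _   = ≈-sym (∷≈[] (toℕ≡0⇒≡0# refl) ≈-refl)
  decode-digit {suc n} n<q with suc n / q | m<n⇒m/n≡0 n<q
  decode-digit {suc zero}    n<q | .0 | refl = ∷-cong (mod≡fromℕ< n<q) ≈-refl
  decode-digit {suc (suc n)} n<q | .0 | refl = ∷-cong (mod≡fromℕ< n<q) ≈-refl

  decode-toℕ : ∀ c → decode (toℕ c) ≈ c ∷ []
  decode-toℕ c = ≈-trans (decode-digit (Finₚ.toℕ<n c)) (∷-cong (Finₚ.fromℕ<-toℕ c _) ≈-refl)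

  q%q≡toℕ0# : q % q ≡ toℕ 0#
  q%q≡toℕ0# = trans (n%n≡0 q) (sym enum-0)

  factor : Poly q → ℕ → Poly q
  factor h n = h ⊝ decode n

  !-as-product : ∀ h → h !ₚ ≡ product (applyUpTo (factor h) (δ h))
  !-as-product h = cong product (map-upTo (factor h) (δ h))

  factor-0 : ∀ h → factor h 0 ≈ h
  factor-0 h = ≈-trans (norm-≈ (h ⊕ [])) (⊕-identityʳ h)

  coeff₀-factor≡0⇒ : ∀ h n → coeff (factor h n) 0 ≡ 0# → n % q ≡ toℕ (coeff h 0)
  coeff₀-factor≡0⇒ h n e = begin
    n % q                          ≡⟨ toℕ-coeff₀-decode n ⟨
    toℕ (coeff (decode n) 0)       ≡⟨ cong toℕ (x∙y⁻¹≈ε⇒x≈y _ _ (trans (sym (coeff-⊝ h (decode n) 0)) e)) ⟨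
    toℕ (coeff h 0)                ∎
    where open ≡-Reasoning

  t∣factor : ∀ h n → n % q ≡ toℕ (coeff h 0) → t ∣ factor h n
  t∣factor h n e = coeff₀≡0⇒t∣ (begin
    coeff (factor h n) 0                  ≡⟨ coeff-⊝ h (decode n) 0 ⟩
    coeff h 0 + - coeff (decode n) 0      ≡⟨ cong (λ x → coeff h 0 + - x) decode₀≡h₀ ⟩
    coeff h 0 + - coeff h 0               ≡⟨ -‿inverseʳ _ ⟩
    0#                                    ∎)
    where
    open ≡-Reasoning
    decode₀≡h₀ : coeff (decode n) 0 ≡ coeff h 0
    decode₀≡h₀ = Finₚ.toℕ-injective (trans (toℕ-coeff₀-decode n) e)

  factor-∣-! : ∀ {a} h {n} → n < δ h → a ∣ factor h n → a ∣ h !ₚ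
  factor-∣-! h n<δh a∣ rewrite !-as-product h = ∣-product (factor h) n<δh a∣

  ⊛-∣-! : ∀ {a b} h {n} → suc n < δ h → a ∣ h → b ∣ factor h (suc n) → a ⊛ b ∣ h !ₚ
  ⊛-∣-! h n<δh a∣h b∣ rewrite !-as-product h =
    ⊛-∣-product (factor h) n<δh (∣-respʳ (≈-sym (factor-0 h)) a∣h) b∣

  self-∣-! : ∀ h → 0 < δ h → h ∣ h !ₚ
  self-∣-! h 0<δh = factor-∣-! h 0<δh (∣-respʳ (≈-sym (factor-0 h)) ∣-refl)

  -- Polynomials f with S(f) ≠ f: a witness h < f with f ∣ h!

  ¬IsS-of : ∀ {f} h → h <ₚ f → f ∣ h !ₚ → ¬ IsS f f
  ¬IsS-of h h<f f∣h! (_ , minimal) = minimal h h<f (∣⇒∣ₚ f∣h!)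

  ¬IsS-const : ∀ {c} → c ≢ 0# → ¬ IsS (c ∷ []) (c ∷ [])
  ¬IsS-const {c} c≢0 = ¬IsS-of [] (subst (0 <_) (sym (δ-[c] c)) (0<toℕ c≢0))
    (∣-respˡ (∷-cong (*-identityʳ c) ≈-refl) (scale-∣ one c≢0))

  -- c + t r = t r − (−c), and −c < t r.
  ¬IsS-unit∷ : ∀ {c r} → c ≢ 0# → 0 < δ r → ¬ IsS (c ∷ r) (c ∷ r)
  ¬IsS-unit∷ {c} {r} c≢0 0<δr =
    ¬IsS-of (0# ∷ r) h<f (factor-∣-! (0# ∷ r) n<δh (∣-respʳ (≈-sym factor≈f) ∣-refl))
    where
    h<f : δ (0# ∷ r) < δ (c ∷ r)
    h<f = subst (_< δ (c ∷ r)) (sym (δ-0∷ r)) (ℕₚ.m<n+m _ (0<toℕ c≢0))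
    n<δh : toℕ (- c) < δ (0# ∷ r)
    n<δh = subst (toℕ (- c) <_) (sym (δ-0∷ r)) (ℕₚ.<-≤-trans (Finₚ.toℕ<n (- c)) (q≤q*n 0<δr))
    factor≈f : factor (0# ∷ r) (toℕ (- c)) ≈ c ∷ r
    factor≈f = begin
      factor (0# ∷ r) (toℕ (- c))          ≈⟨ norm-≈ _ ⟩
      (0# ∷ r) ⊕ (⊖ decode (toℕ (- c)))    ≈⟨ ⊕-cong ≈-refl (⊖-cong (decode-toℕ (- c))) ⟩
      (0# + - (- c)) ∷ (r ⊕ [])            ≈⟨ ∷-cong (trans (+-identityˡ _) (-‿involutive c)) (⊕-identityʳ r) ⟩
      c ∷ r                                ∎
      where open ≈-Reasoning

  ¬IsS-scaled-t : ∀ {c} → c ≢ 0# → c ≢ 1# → ¬ IsS (0# ∷ c ∷ []) (0# ∷ c ∷ [])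
  ¬IsS-scaled-t {c} c≢0 c≢1 = ¬IsS-of t t<f (factor-∣-! t 0<δt (∣-respʳ (≈-sym (factor-0 t)) f∣t))
    where
    t<f : δ t < δ (0# ∷ c ∷ [])
    t<f = subst₂ _<_ (sym δ-t) (sym (trans (δ-0∷ (c ∷ [])) (cong (q ℕ.*_) (δ-[c] c))))
                 (ℕₚ.m<m*n q (toℕ c) (1<toℕ c≢0 c≢1))
    f∣t : (0# ∷ c ∷ []) ∣ t
    f∣t = ∣-respˡ (∷-cong (zeroʳ c) (∷-cong (*-identityʳ c) ≈-refl)) (scale-∣ t c≢0)

  -- t g divides g · (g − m), as t divides g − m.
  ¬IsS-t⊛ : ∀ g m → 0 < m → m < δ g → m % q ≡ toℕ (coeff g 0) → ¬ IsS (0# ∷ g) (0# ∷ g)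
  ¬IsS-t⊛ g (suc m) _ m<δg m≡g₀ =
    ¬IsS-of g g<f (∣-respˡ (⊛-t g) (⊛-∣-! g m<δg ∣-refl (t∣factor g (suc m) m≡g₀)))
    where
    g<f : δ g < δ (0# ∷ g)
    g<f = subst (δ g <_) (sym (δ-0∷ g)) (n<q*n (ℕₚ.<-trans (s≤s z≤n) m<δg))

  -- t² = t · t divides h · (h − t) for h = a₂ t, where a₂ is a third field element.
  ¬IsS-t² : 2 < q → ¬ IsS t² t²
  ¬IsS-t² 2<q = ¬IsS-of h h<t² (∣-respˡ (⊛-t t) (⊛-∣-! h q<δh (coeff₀≡0⇒t∣ refl) (t∣factor h q q%q≡toℕ0#)))
    where
    a₂ : Fin q
    a₂ = Fin.fromℕ< 2<q
    h : Poly q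
    h = 0# ∷ a₂ ∷ []
    δh : δ h ≡ q ℕ.* 2
    δh = trans (δ-0∷ (a₂ ∷ [])) (cong (q ℕ.*_) (trans (δ-[c] a₂) (Finₚ.toℕ-fromℕ< 2<q)))
    q<δh : q < δ h
    q<δh = subst (q <_) (sym δh) (ℕₚ.m<m*n q 2 (s≤s (s≤s z≤n)))
    h<t² : δ h < δ t²
    h<t² = subst₂ _<_ (sym δh) (sym δ-t²) (ℕₚ.*-monoʳ-< q 2<q)

  ¬IsS-t²⊛ : ∀ r → 1 < δ r → ¬ IsS (0# ∷ 0# ∷ r) (0# ∷ 0# ∷ r)
  ¬IsS-t²⊛ r 1<δr = ¬IsS-t⊛ (0# ∷ r) q (s≤s z≤n) q<δg q%q≡toℕ0#
    where
    q<δg : q < δ (0# ∷ r)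
    q<δg = subst (q <_) (sym (δ-0∷ r)) (ℕₚ.m<m*n q (δ r) 1<δr)

  -- The fixed points t and t²

  t∤-! : ∀ h → δ h < q → t∤ (h !ₚ)
  t∤-! h δh<q rewrite !-as-product h = t∤-product (factor h) (δ h) λ n n<δh factor₀≡0 →
    ℕₚ.<⇒≢ n<δh (begin
      n                  ≡⟨ m<n⇒m%n≡m (ℕₚ.<-trans n<δh δh<q) ⟨
      n % q              ≡⟨ coeff₀-factor≡0⇒ h n factor₀≡0 ⟩
      toℕ (coeff h 0)    ≡⟨ toℕ-coeff₀ h δh<q ⟩
      δ h                ∎)
    where open ≡-Reasoning

  -- n = n % q + (n / q) q with n % q = h₀, and n / q < δ (drop 1 h) ≤ 1.
  t∣factor⇒≡coeff₀ : ∀ h n → n < δ h → δ (drop 1 h) ≤ 1 → coeff (factor h n) 0 ≡ 0# →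
                     n ≡ toℕ (coeff h 0)
  t∣factor⇒≡coeff₀ h n n<δh d≤1 factor₀≡0 = begin
    n                              ≡⟨ m≡m%n+[m/n]*n n q ⟩
    n % q ℕ.+ n / q ℕ.* q          ≡⟨ cong₂ (λ r s → r ℕ.+ s ℕ.* q) n%q≡h₀ n/q≡0 ⟩
    toℕ (coeff h 0) ℕ.+ 0          ≡⟨ ℕₚ.+-identityʳ _ ⟩
    toℕ (coeff h 0)                ∎
    where
    open ≡-Reasoning
    n%q≡h₀ : n % q ≡ toℕ (coeff h 0)
    n%q≡h₀ = coeff₀-factor≡0⇒ h n factor₀≡0
    n≡h₀+q*[n/q] : n ≡ toℕ (coeff h 0) ℕ.+ q ℕ.* (n / q)
    n≡h₀+q*[n/q] = trans (m≡m%n+[m/n]*n n q) (cong₂ ℕ._+_ n%q≡h₀ (ℕₚ.*-comm (n / q) q))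
    n/q≡0 : n / q ≡ 0
    n/q≡0 = ℕₚ.n<1⇒n≡0 (ℕₚ.<-≤-trans (ℕₚ.*-cancelˡ-< q _ _ (ℕₚ.+-cancelˡ-< (toℕ (coeff h 0)) _ _
              (subst₂ _<_ n≡h₀+q*[n/q] (δ-coeff₀ h) n<δh))) d≤1)

  t²∤-factor-coeff₀ : ∀ h → δ (drop 1 h) ≡ 1 → t²∤ factor h (toℕ (coeff h 0))
  t²∤-factor-coeff₀ h d≡1 (_ , factor₁≡0) = 0≢1 (begin
    0#                            ≡⟨ at (decode-toℕ h₀) 1 ⟨
    coeff (decode (toℕ h₀)) 1     ≡⟨ x∙y⁻¹≈ε⇒x≈y _ _ (trans (sym (coeff-⊝ h (decode (toℕ h₀)) 1)) factor₁≡0) ⟨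
    coeff h 1                     ≡⟨ coeff-drop1 h 0 ⟨
    coeff (drop 1 h) 0            ≡⟨ toℕ≡1⇒≡1# (trans (toℕ-coeff₀ (drop 1 h) (subst (_< q) (sym d≡1) (s≤s (s≤s z≤n)))) d≡1) ⟩
    1#                            ∎)
    where
    open ≡-Reasoning
    h₀ : Fin q
    h₀ = coeff h 0

  -- Below 2q at most the factor h − h₀ is divisible by t, and it is then t itself.
  t²∤-! : ∀ h → δ h < q ℕ.* 2 → t²∤ (h !ₚ)
  t²∤-! h δh<2q rewrite !-as-product h = t²∤-product (factor h) (δ h) (toℕ (coeff h 0))
    (λ n n<δh n≢h₀ factor₀≡0 → n≢h₀ (t∣factor⇒≡coeff₀ h n n<δh d≤1 factor₀≡0))
    (λ h₀<δh → t²∤-factor-coeff₀ h (ℕₚ.≤-antisym d≤1 (0<d h₀<δh)))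
    where
    d≤1 : δ (drop 1 h) ≤ 1
    d≤1 = ℕₚ.≤-pred (ℕₚ.*-cancelˡ-< q _ 2 (ℕₚ.≤-<-trans (ℕₚ.m≤n+m _ (toℕ (coeff h 0))) (subst (_< q ℕ.* 2) (δ-coeff₀ h) δh<2q)))
    0<d : toℕ (coeff h 0) < δ h → 0 < δ (drop 1 h)
    0<d h₀<δh = ℕₚ.*-cancelˡ-< q 0 _ (subst (_< q ℕ.* δ (drop 1 h)) (sym (ℕₚ.*-zeroʳ q))
                  (ℕₚ.+-cancelˡ-< (toℕ (coeff h 0)) _ _ (subst₂ _<_ (sym (ℕₚ.+-identityʳ _)) (δ-coeff₀ h) h₀<δh)))

  IsS-t : IsS t t
  IsS-t = ∣⇒∣ₚ (self-∣-! t 0<δt) , λ h h<t t∣h! →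
    t∤-! h (subst (δ h <_) δ-t h<t) (t∣⇒coeff₀≡0 (∣ₚ⇒∣ {P = h !ₚ} t∣h!))

  IsS-t² : q ≡ 2 → IsS t² t²
  IsS-t² q≡2 = ∣⇒∣ₚ (self-∣-! t² (subst (0 <_) (sym δ-t²) (s≤s z≤n))) , λ h h<t² t²∣h! →
    t²∤-! h (subst (δ h <_) (trans δ-t² (cong (q ℕ.*_) q≡2)) h<t²) (t²∣⇒coeff₀₁≡0 (∣ₚ⇒∣ {P = h !ₚ} t²∣h!))

  t²⊛-fixed-point⇒t⊎t² : ∀ e r → Canonical (e ∷ r) → IsS (0# ∷ 0# ∷ e ∷ r) (0# ∷ 0# ∷ e ∷ r) →
                    0# ∷ 0# ∷ e ∷ r ≡ t ⊎ (0# ∷ 0# ∷ e ∷ r ≡ t² × ¬ 2 < q)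
  t²⊛-fixed-point⇒t⊎t² e [] can s with e Fin.≟ 1#
  ... | yes refl = inj₂ (refl , λ 2<q → ¬IsS-t² 2<q s)
  ... | no e≢1   = ⊥-elim (¬IsS-t²⊛ (e ∷ []) (subst (1 <_) (sym (δ-[c] e)) (1<toℕ (canonical-[c] can) e≢1)) s)
  t²⊛-fixed-point⇒t⊎t² e (e′ ∷ r) can s = ⊥-elim (¬IsS-t²⊛ (e ∷ e′ ∷ r) 1<δ s)
    where
    1<δ : 1 < δ (e ∷ e′ ∷ r)
    1<δ = ℕₚ.<-≤-trans (s≤s (s≤s z≤n)) (ℕₚ.≤-trans (q≤q*n (δ-pos (canonical-tail can) λ ())) (ℕₚ.m≤n+m _ (toℕ e)))

  t⊛-fixed-point⇒t⊎t² : ∀ d r → Canonical (d ∷ r) → IsS (0# ∷ d ∷ r) (0# ∷ d ∷ r) →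
                   0# ∷ d ∷ r ≡ t ⊎ (0# ∷ d ∷ r ≡ t² × ¬ 2 < q)
  t⊛-fixed-point⇒t⊎t² d [] can s with d Fin.≟ 1#
  ... | yes refl = inj₁ refl
  ... | no d≢1   = ⊥-elim (¬IsS-scaled-t (canonical-[c] can) d≢1 s)
  t⊛-fixed-point⇒t⊎t² d (e ∷ r) can s with d Fin.≟ 0#
  ... | yes refl = t²⊛-fixed-point⇒t⊎t² e r (canonical-tail can) s
  ... | no d≢0   = ⊥-elim (¬IsS-t⊛ (d ∷ e ∷ r) (toℕ d) (0<toℕ d≢0) d<δ (m<n⇒m%n≡m (Finₚ.toℕ<n d)) s)
    where
    d<δ : toℕ d < δ (d ∷ e ∷ r)
    d<δ = ℕₚ.m<m+n (toℕ d) (ℕₚ.<-≤-trans (δ-pos (canonical-tail can) λ ()) (ℕₚ.m≤n*m _ q))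

  fixed-point⇒t⊎t² : ∀ f → Canonical f → f ≢ [] → IsS f f → f ≡ t ⊎ (f ≡ t² × ¬ 2 < q)
  fixed-point⇒t⊎t² []          _   f≢[] _ = ⊥-elim (f≢[] refl)
  fixed-point⇒t⊎t² (c ∷ [])    can _    s = ⊥-elim (¬IsS-const (canonical-[c] can) s)
  fixed-point⇒t⊎t² (c ∷ d ∷ r) can _    s with c Fin.≟ 0#
  ... | yes refl = t⊛-fixed-point⇒t⊎t² d r (canonical-tail can) s
  ... | no c≢0   = ⊥-elim (¬IsS-unit∷ c≢0 (δ-pos (canonical-tail can) λ ()) s)

field-size≥2 : ∀ {q} → FiniteField q → 2 ≤ q
field-size≥2 F = subst (_< _) (FiniteField.enum-1 F) (Finₚ.toℕ<n (FiniteField.1# F))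

proposition3p11 : (q : ℕ) (F : FiniteField q) (f : Poly q) →
    PolyOps.Canonical F f → f ≢ [] →
    (2 < q → (PolyOps.IsS F f f ⇔ f ≡ PolyOps.t F))
    × (q ≡ 2 → (PolyOps.IsS F f f ⇔ (f ≡ PolyOps.t F ⊎ f ≡ PolyOps.t² F)))
proposition3p11 q F f can f≢[] with field-size≥2 F
... | s≤s (s≤s {n = k} _) = fixed-points-for-q>2 , fixed-points-for-q≡2
  where
  open PolyOps F
  open FixedPoints k F hiding (q)
  IsS-≡ : ∀ {g} → f ≡ g → IsS g g → IsS f f
  IsS-≡ f≡g = subst (λ g → IsS g g) (sym f≡g)
  fixed-points-for-q>2 : 2 < q → IsS f f ⇔ f ≡ t
  fixed-points-for-q>2 2<q = mk⇔
    ([ id , (λ (_ , ¬2<q) → ⊥-elim (¬2<q 2<q)) ]′ ∘ fixed-point⇒t⊎t² f can f≢[])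
    (λ f≡t → IsS-≡ f≡t IsS-t)
  fixed-points-for-q≡2 : q ≡ 2 → IsS f f ⇔ (f ≡ t ⊎ f ≡ t²)
  fixed-points-for-q≡2 q≡2 = mk⇔
    (Sum.map₂ proj₁ ∘ fixed-point⇒t⊎t² f can f≢[])
    [ (λ f≡t → IsS-≡ f≡t IsS-t) , (λ f≡t² → IsS-≡ f≡t² (IsS-t² q≡2)) ]′
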